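{- Let $G=(V,E)$ be a connected graph with $n=|V|$, and let $r,r_1\in V$ with $rr_1\in E$. Let $D=(V,A)$ be the directed graph obtained from $G$ as follows: every edge $vr\in E$ becomes the arc $(r,v)$; every edge $vr_1\in E$ with $v\neq r$ becomes the arc $(r_1,v)$; every other edge $uv\in E$ is replaced by the two arcs $(u,v)$ and $(v,u)$. Let $C\subseteq V$. Then $C$ is a connected vertex cover of $G$ if and only if there exist $z\in\{0,1\}^A$ and $d\in\mathbb R^V$ such that, with $x=\chi^C\in\{0,1\}^V$, the following hold: (i) $x_u+x_v\geq 1$ for every arc $(u,v)\in A$; (ii) $z(\delta^-(v))=x_v$ for every $v\in V\setminus\{r,r_1\}$; (iii) $d_v\geq n\cdot(z_{uv}-1)+d_u+x_v$ for every arc $(u,v)\in A$; (iv) $d_r=0$; (v) $z(A)=x(V)-1$; (vi) $z_{uv}\leq x_u$ and $z_{uv}\leq x_v$ for every arc $(u,v)\in A$.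
   Context: A set $C\subseteq V$ is a vertex cover of $G$ if every edge of $G$ has at least one endpoint in $C$; it is a connected vertex cover if moreover the induced subgraph $G[C]$ is connected. For $v\in V$, $\delta^-(v)$ is the set of arcs of $A$ with head $v$. For a finite set $A$ and $U\subseteq A$, $\chi^U\in\{0,1\}^A$ is the incidence vector of $U$, and for $x\in\mathbb R^A$, $x(U)=\sum_{a\in U}x_a$.
   Formalization: The vector $d$ has entries in ℚ instead of ℝ. -}

module Defs where

open import Data.Nat using (ℕ; zero; suc; _+_)
open import Data.Bool using (Bool; true; false; _∧_; _∨_; not; T)
open import Data.Fin using (Fin; zero; suc)
open import Data.Fin.Properties using (_≟_)
open import Data.Product using (_×_; Σ; ∃)
open import Relation.Nullary.Decidable using (⌊_⌋)
open import Relation.Binary.PropositionalEquality using (_≡_)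
open import Relation.Nullary using (¬_)
open import Data.Integer as ℤ using (ℤ; +_)
open import Data.Rational using (ℚ; _/_)

record Graph (n : ℕ) : Set where
  field
    adj   : Fin n → Fin n → Bool
    sym   : ∀ u v → adj u v ≡ adj v u
    irrefl : ∀ v → adj v v ≡ false

open Graph public

Edge : ∀ {n} → Graph n → Fin n → Fin n → Set
Edge G u v = T (adj G u v)

data WalkIn {n} (G : Graph n) (S : Fin n → Bool) : Fin n → Fin n → Set where
  here : ∀ {v} → T (S v) → WalkIn G S v v
  step : ∀ {u w v} → T (S u) → Edge G u w → WalkIn G S w v → WalkIn G S u v

InducedConnected : ∀ {n} → Graph n → (Fin n → Bool) → Set
InducedConnected G S = ∀ u v → T (S u) → T (S v) → WalkIn G S u v

Connected : ∀ {n} → Graph n → Set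
Connected G = InducedConnected G (λ _ → true)

VertexCover : ∀ {n} → Graph n → (Fin n → Bool) → Set
VertexCover G C = ∀ u v → Edge G u v → T (C u ∨ C v)

ConnectedVertexCover : ∀ {n} → Graph n → (Fin n → Bool) → Set
ConnectedVertexCover G C = VertexCover G C × InducedConnected G C

_==_ : ∀ {n} → Fin n → Fin n → Bool
u == v = ⌊ u ≟ v ⌋

-- The arc set A of the digraph D obtained from G, r, r₁:
--  * edge vr  becomes arc (r , v);
--  * edge vr₁ with v ≠ r becomes arc (r₁ , v);
--  * every other edge uv becomes both arcs (u , v) and (v , u).
-- arc u v = true iff (u , v) ∈ A.
arc : ∀ {n} → Graph n → Fin n → Fin n → Fin n → Fin n → Bool
arc G r r₁ u v =
  adj G u v ∧
  ( (u == r)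
  ∨ ((u == r₁) ∧ not (v == r))
  ∨ (not (u == r) ∧ not (u == r₁) ∧ not (v == r) ∧ not (v == r₁)))

Arc : ∀ {n} → Graph n → Fin n → Fin n → Fin n → Fin n → Set
Arc G r r₁ u v = T (arc G r r₁ u v)

b2n : Bool → ℕ
b2n true  = 1
b2n false = 0

sumFin : ∀ n → (Fin n → ℕ) → ℕ
sumFin zero    f = 0
sumFin (suc n) f = f zero + sumFin n (λ i → f (suc i))

onArc : ∀ {n} → Graph n → Fin n → Fin n → (Fin n → Fin n → Bool) → Fin n → Fin n → ℕ
onArc G r r₁ z u v = b2n (arc G r r₁ u v ∧ z u v)

zIn : ∀ {n} → Graph n → Fin n → Fin n → (Fin n → Fin n → Bool) → Fin n → ℕ
zIn {n} G r r₁ z v = sumFin n (λ u → onArc G r r₁ z u v)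

zAll : ∀ {n} → Graph n → Fin n → Fin n → (Fin n → Fin n → Bool) → ℕ
zAll {n} G r r₁ z = sumFin n (λ u → sumFin n (λ v → onArc G r r₁ z u v))

xAll : ∀ {n} → (Fin n → Bool) → ℕ
xAll {n} x = sumFin n (λ v → b2n (x v))

b2z : Bool → ℤ
b2z b = + b2n b

toℚ : ℤ → ℚ
toℚ k = k / 1

module Submission where

-- A connected vertex cover C gives a solution through a breadth-first spanning tree of G[C], rooted at
-- r if r ∈ C and at r₁ otherwise: z marks the tree arcs (parent v, v) and d is the depth. Depths are
-- at most n − 1, so (iii) is slack on non-tree arcs, while on tree arcs it reads d_v ≥ d_u + 1.
-- Breadth-first search makes r the parent of r₁, so every tree arc is an arc of D. Conversely, by (ii),
-- (vi) and (iii) every vertex of C other than r, r₁ has a neighbour in C of strictly smaller potential d;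
-- descending along these neighbours ends in r or r₁, which are adjacent, so G[C] is connected, and (i)
-- makes C a vertex cover.

open import Defs hiding (sym)
open import Data.Nat using (ℕ; zero; suc; _+_; _∸_; _≤_; _<_; _≥_; z≤n; s≤s)
import Data.Nat.Properties as ℕP
open import Data.Nat.Induction using (<-wellFounded)
open import Data.Nat.Coprimality as Coprime using (1-coprimeTo)
open import Data.Fin using (Fin; zero; suc; punchIn)
open import Data.Fin.Properties using (_≟_; punchInᵢ≢i; any?)
open import Data.Bool using (Bool; true; false; _∧_; _∨_; not; T; if_then_else_)
open import Data.Bool.Properties using (T-≡; T-∧; T-∨; ∧-identityʳ; ∧-zeroʳ; ∨-comm)
open import Data.Product using (Σ; ∃; _×_; _,_; proj₁; proj₂)
open import Data.Sum using (_⊎_; inj₁; inj₂; [_,_])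
open import Data.Unit using (tt)
open import Data.Empty using (⊥-elim)
open import Data.Integer as ℤ using (ℤ; +_)
import Data.Integer.Properties as ℤP
open import Data.Rational as ℚ using (ℚ; mkℚ)
import Data.Rational.Properties as ℚP
open import Function using (_∘_; _on_)
open import Function.Bundles using (_⇔_; mk⇔; Equivalence)
open import Induction.WellFounded using (Acc; acc)
open import Relation.Binary using (DecStrictPartialOrder; StrictTotalOrder)
import Relation.Binary.Construct.On as On
open import Relation.Binary.PropositionalEquality
  using (_≡_; _≢_; refl; sym; trans; cong; cong₂; subst; subst₂; module ≡-Reasoning)
open import Relation.Nullary using (¬_; Dec; yes; no; contradiction)
open import Relation.Nullary.Decidable
  using (⌊_⌋; True; T?; _×-dec_; _⊎-dec_; ¬?; toWitness; fromWitness; toWitnessFalse; dec-true; dec-false; isYes≗does)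
open import Relation.Unary using (Pred; Decidable)
import Algebra.Properties.CommutativeMonoid.Sum ℕP.+-0-commutativeMonoid as Sum

==-refl : ∀ {n} (v : Fin n) → (v == v) ≡ true
==-refl v = trans (isYes≗does (v ≟ v)) (dec-true (v ≟ v) refl)

==-≢ : ∀ {n} {u v : Fin n} → u ≢ v → (u == v) ≡ false
==-≢ {u = u} {v} u≢v = trans (isYes≗does (u ≟ v)) (dec-false (u ≟ v) u≢v)

b2n-mono : ∀ {a b} → (T a → T b) → b2n a ≤ b2n b
b2n-mono {false}         a⇒b = z≤n
b2n-mono {true} {true}   a⇒b = ℕP.≤-refl
b2n-mono {true} {false}  a⇒b = ⊥-elim (a⇒b tt)

b2n-mono-< : ∀ {a b} → ¬ T a → T b → b2n a < b2n b
b2n-mono-< {true}  ¬a b = ⊥-elim (¬a tt)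
b2n-mono-< {false} {true} ¬a b = s≤s z≤n

b2n≤1 : ∀ b → b2n b ≤ 1
b2n≤1 false = z≤n
b2n≤1 true  = s≤s z≤n

b2n≢0⇒T : ∀ {b} → b2n b ≢ 0 → T b
b2n≢0⇒T {true}  _    = tt
b2n≢0⇒T {false} b≢0 = contradiction refl b≢0

b2n-≤⇒ : ∀ {a b} → b2n a ≤ b2n b → T a → T b
b2n-≤⇒ {true} {true} _ _ = tt

b2n-sum⇒∨ : ∀ a b → b2n a + b2n b ≥ 1 → T (a ∨ b)
b2n-sum⇒∨ true  b     _ = tt
b2n-sum⇒∨ false true  _ = tt

∨⇒b2n-sum : ∀ a b → T (a ∨ b) → b2n a + b2n b ≥ 1
∨⇒b2n-sum true  b     _ = s≤s z≤n
∨⇒b2n-sum false true  _ = s≤s z≤n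

sumFin≡sum : ∀ n (f : Fin n → ℕ) → sumFin n f ≡ Sum.sum f
sumFin≡sum zero    f = refl
sumFin≡sum (suc n) f = cong (_+_ (f zero)) (sumFin≡sum n (f ∘ suc))

sumFin-cong : ∀ n {f g : Fin n → ℕ} → (∀ i → f i ≡ g i) → sumFin n f ≡ sumFin n g
sumFin-cong zero    f≗g = refl
sumFin-cong (suc n) f≗g = cong₂ _+_ (f≗g zero) (sumFin-cong n (f≗g ∘ suc))

sumFin-distrib-+ : ∀ n (f g : Fin n → ℕ) → sumFin n (λ i → f i + g i) ≡ sumFin n f + sumFin n g
sumFin-distrib-+ n f g = begin
  sumFin n (λ i → f i + g i)  ≡⟨ sumFin≡sum n _ ⟩
  Sum.sum (λ i → f i + g i)   ≡⟨ Sum.∑-distrib-+ f g ⟩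
  Sum.sum f + Sum.sum g       ≡⟨ sym (cong₂ _+_ (sumFin≡sum n f) (sumFin≡sum n g)) ⟩
  sumFin n f + sumFin n g     ∎
  where open ≡-Reasoning

sumFin-comm : ∀ m n (f : Fin m → Fin n → ℕ) →
  sumFin m (λ i → sumFin n (f i)) ≡ sumFin n (λ j → sumFin m (λ i → f i j))
sumFin-comm m n f = begin
  sumFin m (λ i → sumFin n (f i))          ≡⟨ sumFin≡sum m _ ⟩
  Sum.sum (λ i → sumFin n (f i))           ≡⟨ Sum.sum-cong-≗ (λ i → sumFin≡sum n (f i)) ⟩
  Sum.sum (λ i → Sum.sum (f i))            ≡⟨ Sum.∑-comm f ⟩
  Sum.sum (λ j → Sum.sum (λ i → f i j))    ≡⟨ Sum.sum-cong-≗ (λ j → sym (sumFin≡sum m (λ i → f i j))) ⟩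
  Sum.sum (λ j → sumFin m (λ i → f i j))   ≡⟨ sym (sumFin≡sum n _) ⟩
  sumFin n (λ j → sumFin m (λ i → f i j))  ∎
  where open ≡-Reasoning

sumFin-single : ∀ n (f : Fin n → ℕ) i → (∀ j → j ≢ i → f j ≡ 0) → sumFin n f ≡ f i
sumFin-single (suc n) f i others-zero = begin
  sumFin (suc n) f               ≡⟨ sumFin≡sum (suc n) f ⟩
  Sum.sum f                      ≡⟨ Sum.sum-remove f ⟩
  f i + Sum.sum (f ∘ punchIn i)  ≡⟨ cong (_+_ (f i)) (Sum.sum-cong-≗ {n} (λ j → others-zero _ (punchInᵢ≢i i j))) ⟩
  f i + Sum.sum {n} (λ _ → 0)    ≡⟨ cong (_+_ (f i)) (Sum.sum-replicate-zero n) ⟩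
  f i + 0                        ≡⟨ ℕP.+-identityʳ (f i) ⟩
  f i                            ∎
  where open ≡-Reasoning

sumFin-mono-≤ : ∀ n {f g : Fin n → ℕ} → (∀ i → f i ≤ g i) → sumFin n f ≤ sumFin n g
sumFin-mono-≤ zero    f≤g = z≤n
sumFin-mono-≤ (suc n) f≤g = ℕP.+-mono-≤ (f≤g zero) (sumFin-mono-≤ n (f≤g ∘ suc))

sumFin-mono-< : ∀ n {f g : Fin n → ℕ} → (∀ i → f i ≤ g i) → ∀ i → f i < g i → sumFin n f < sumFin n g
sumFin-mono-< (suc n) f≤g zero    fi<gi = ℕP.+-mono-<-≤ fi<gi (sumFin-mono-≤ n (f≤g ∘ suc))
sumFin-mono-< (suc n) f≤g (suc i) fi<gi = ℕP.+-mono-≤-< (f≤g zero) (sumFin-mono-< n (f≤g ∘ suc) i fi<gi)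

sumFin-nonzero : ∀ n (f : Fin n → ℕ) → sumFin n f ≢ 0 → ∃ λ i → f i ≢ 0
sumFin-nonzero zero    f sum≢0 = ⊥-elim (sum≢0 refl)
sumFin-nonzero (suc n) f sum≢0 with f zero ℕP.≟ 0
... | no f0≢0 = zero , f0≢0
... | yes f0≡0 with sumFin-nonzero n (f ∘ suc) (λ rest≡0 → sum≢0 (cong₂ _+_ f0≡0 rest≡0))
... | i , fi≢0 = suc i , fi≢0

xAll-mono-< : ∀ {n} {P Q : Fin n → Bool} → (∀ v → T (P v) → T (Q v)) →
  ∀ v → T (Q v) → ¬ T (P v) → xAll P < xAll Q
xAll-mono-< {n} P⊆Q v Qv ¬Pv = sumFin-mono-< n (λ w → b2n-mono (P⊆Q w)) v (b2n-mono-< ¬Pv Qv)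

xAll-singleton : ∀ {n} (v : Fin n) → xAll (_== v) ≡ 1
xAll-singleton {n} v =
  trans (sumFin-single n _ v (λ u u≢v → cong b2n (==-≢ u≢v))) (cong b2n (==-refl v))

xAll-const-true : ∀ n → xAll {n} (λ _ → true) ≡ n
xAll-const-true zero    = refl
xAll-const-true (suc n) = cong suc (xAll-const-true n)

xAll-full : ∀ {n} (P : Fin n → Bool) → n ≤ xAll P → ∀ v → T (P v)
xAll-full {n} P n≤∣P∣ v with T? (P v)
... | yes Pv = Pv
... | no ¬Pv = contradiction (subst (xAll P <_) (xAll-const-true n) (xAll-mono-< (λ _ _ → tt) v tt ¬Pv))
                             (ℕP.≤⇒≯ n≤∣P∣)

-- The least i ≤ b with T (f i), and b when there is none.
firstTrue : (ℕ → Bool) → ℕ → ℕ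
firstTrue f zero    = zero
firstTrue f (suc b) = if f zero then zero else suc (firstTrue (f ∘ suc) b)

firstTrue-≤ : ∀ f b → firstTrue f b ≤ b
firstTrue-≤ f zero    = z≤n
firstTrue-≤ f (suc b) with f zero
... | true  = z≤n
... | false = s≤s (firstTrue-≤ (f ∘ suc) b)

firstTrue-least : ∀ f b {i} → T (f i) → firstTrue f b ≤ i
firstTrue-least f zero    fi = z≤n
firstTrue-least f (suc b) {i} fi with f zero in f0≡
... | true  = z≤n
firstTrue-least f (suc b) {zero}  fi | false = contradiction (subst T f0≡ fi) (λ ())
firstTrue-least f (suc b) {suc i} fi | false = s≤s (firstTrue-least (f ∘ suc) b fi)

firstTrue-holds : ∀ (f : ℕ → Bool) b → T (f b) → T (f (firstTrue f b))
firstTrue-holds f zero    fb = fb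
firstTrue-holds f (suc b) fb with f zero in f0≡
... | true  = subst T (sym f0≡) tt
... | false = firstTrue-holds (f ∘ suc) b fb

edge-sym : ∀ {n} (G : Graph n) {u v} → Edge G u v → Edge G v u
edge-sym G {u} {v} = subst T (Graph.sym G u v)

walk-start : ∀ {n} {G : Graph n} {S u v} → WalkIn G S u v → T (S u)
walk-start (here Su)     = Su
walk-start (step Su _ _) = Su

walk-end : ∀ {n} {G : Graph n} {S u v} → WalkIn G S u v → T (S v)
walk-end (here Sv)     = Sv
walk-end (step _ _ w) = walk-end w

walk-++ : ∀ {n} {G : Graph n} {S u v w} → WalkIn G S u v → WalkIn G S v w → WalkIn G S u w
walk-++ (here _)      w′ = w′
walk-++ (step Su e w) w′ = step Su e (walk-++ w w′)

walk-reverse : ∀ {n} {G : Graph n} {S u v} → WalkIn G S u v → WalkIn G S v u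
walk-reverse         (here Sv)     = here Sv
walk-reverse {G = G} (step Su e w) = walk-++ (walk-reverse w) (step (walk-start w) (edge-sym G e) (here Su))

connected-via-hub : ∀ {n} (G : Graph n) S h → (∀ v → T (S v) → WalkIn G S v h) → InducedConnected G S
connected-via-hub G S h to-hub u v Su Sv = walk-++ (to-hub u Su) (walk-reverse (to-hub v Sv))

connected-via-edge : ∀ {n} (G : Graph n) S {h h′} → Edge G h h′ →
  (∀ v → T (S v) → ∃ λ w → (w ≡ h ⊎ w ≡ h′) × WalkIn G S v w) → InducedConnected G S
connected-via-edge G S {h} {h′} e to-ends with T? (S h′)
... | yes Sh′ = connected-via-hub G S h′ to-h′
  where
  to-h′ : ∀ v → T (S v) → WalkIn G S v h′
  to-h′ v Sv with to-ends v Sv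
  ... | _ , inj₁ refl , w = walk-++ w (step (walk-end w) e (here Sh′))
  ... | _ , inj₂ refl , w = w
... | no ¬Sh′ = connected-via-hub G S h to-h
  where
  to-h : ∀ v → T (S v) → WalkIn G S v h
  to-h v Sv with to-ends v Sv
  ... | _ , inj₁ refl , w = w
  ... | _ , inj₂ refl , w = contradiction (walk-end w) ¬Sh′

module _ {n} (G : Graph n) (r r₁ : Fin n) where

  arc⇒edge : ∀ {u v} → Arc G r r₁ u v → Edge G u v
  arc⇒edge a = proj₁ (Equivalence.to T-∧ a)

  arc-from-r : ∀ {v} → Edge G r v → Arc G r r₁ r v
  arc-from-r e rewrite Equivalence.to T-≡ e | ==-refl r = tt

  arc-intro : ∀ {u v} → Edge G u v → v ≢ r → u ≡ r₁ ⊎ v ≢ r₁ → Arc G r r₁ u v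
  arc-intro {u} {v} e v≢r u≡r₁⊎v≢r₁ rewrite Equivalence.to T-≡ e with u ≟ r | v ≟ r | u ≟ r₁ | v ≟ r₁
  ... | yes _ | _       | _       | _        = tt
  ... | no _  | yes v≡r | _       | _        = contradiction v≡r v≢r
  ... | no _  | no _    | yes _   | _        = tt
  ... | no _  | no _    | no u≢r₁ | yes v≡r₁ =
    [ (λ u≡r₁ → contradiction u≡r₁ u≢r₁) , contradiction v≡r₁ ] u≡r₁⊎v≢r₁
  ... | no _  | no _    | no _    | no _     = tt

  edge⇒arc : ∀ {u v} → Edge G u v → Arc G r r₁ u v ⊎ Arc G r r₁ v u
  edge⇒arc {u} {v} e = orient (u ≟ r) (v ≟ r) (u ≟ r₁) (v ≟ r₁)
    where
    orient : Dec (u ≡ r) → Dec (v ≡ r) → Dec (u ≡ r₁) → Dec (v ≡ r₁) → Arc G r r₁ u v ⊎ Arc G r r₁ v u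
    orient (yes refl) _          _          _          = inj₁ (arc-from-r e)
    orient (no _)     (yes refl) _          _          = inj₂ (arc-from-r (edge-sym G e))
    orient (no _)     (no v≢r)   (yes u≡r₁) _          = inj₁ (arc-intro e v≢r (inj₁ u≡r₁))
    orient (no u≢r)   (no _)     (no _)     (yes v≡r₁) = inj₂ (arc-intro (edge-sym G e) u≢r (inj₁ v≡r₁))
    orient (no _)     (no v≢r)   (no _)     (no v≢r₁)  = inj₁ (arc-intro e v≢r (inj₂ v≢r₁))

incoming-z-arc : ∀ {n} (G : Graph n) r r₁ z {v} → zIn G r r₁ z v ≡ 1 → ∃ λ u → Arc G r r₁ u v × T (z u v)
incoming-z-arc {n} G r r₁ z {v} zIn≡1
  with sumFin-nonzero n (λ u → onArc G r r₁ z u v) (λ zIn≡0 → ℕP.1+n≢0 (trans (sym zIn≡1) zIn≡0))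
... | u , uv-chosen = u , Equivalence.to T-∧ (b2n≢0⇒T uv-chosen)

module BreadthFirstTree {n} (G : Graph (suc n)) (S : Fin (suc n) → Bool)
  (root : Fin (suc n)) (root∈S : T (S root)) (S-connected : InducedConnected G S) where

  V : Set
  V = Fin (suc n)

  incoming : (P : V → Bool) (v : V) → Dec (∃ λ u → T (P u ∧ adj G u v))
  incoming P v = any? (λ u → T? (P u ∧ adj G u v))

  reach : ℕ → V → Bool
  reach zero    v = v == root
  reach (suc k) v = reach k v ∨ (S v ∧ ⌊ incoming (reach k) v ⌋)

  reach-mono : ∀ k {v} → T (reach k v) → T (reach (suc k) v)
  reach-mono k = Equivalence.from T-∨ ∘ inj₁

  reach-root : ∀ k → T (reach k root)
  reach-root zero    = fromWitness refl
  reach-root (suc k) = reach-mono k (reach-root k)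

  reach⊆S : ∀ k {v} → T (reach k v) → T (S v)
  reach⊆S zero    v≡root = subst (T ∘ S) (sym (toWitness v≡root)) root∈S
  reach⊆S (suc k) rv with Equivalence.to T-∨ rv
  ... | inj₁ rₖv = reach⊆S k rₖv
  ... | inj₂ new = proj₁ (Equivalence.to T-∧ new)

  reach-step : ∀ k {u v} → T (reach k u) → Edge G u v → T (S v) → T (reach (suc k) v)
  reach-step k ru e Sv = Equivalence.from T-∨
    (inj₂ (Equivalence.from T-∧ (Sv , fromWitness (_ , Equivalence.from T-∧ (ru , e)))))

  reach-new : ∀ k {v} → T (reach (suc k) v) → ¬ T (reach k v) → True (incoming (reach k) v)
  reach-new k rv ¬rₖv with Equivalence.to T-∨ rv
  ... | inj₁ rₖv = contradiction rₖv ¬rₖv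
  ... | inj₂ new = proj₂ (Equivalence.to T-∧ new)

  Closed : ℕ → Set
  Closed k = ∀ {u v} → T (reach k u) → Edge G u v → T (S v) → T (reach k v)

  closed-suc : ∀ {k} → Closed k → Closed (suc k)
  closed-suc {k} closed {u} ru e Sv = reach-mono k (closed settled e Sv)
    where
    settled : T (reach k u)
    settled with T? (reach k u)
    ... | yes rₖu = rₖu
    ... | no ¬rₖu with toWitness {a? = incoming (reach k) u} (reach-new k ru ¬rₖu)
    ...   | w , wu = let rₖw , ewu = Equivalence.to T-∧ wu in closed rₖw ewu (reach⊆S (suc k) ru)

  -- reach 0 has one vertex and each later step adds one until the set is closed; there are n + 1 vertices.
  grows-or-closed : ∀ k → suc k ≤ xAll (reach k) ⊎ Closed k
  grows-or-closed zero    = inj₁ (ℕP.≤-reflexive (sym (xAll-singleton root)))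
  grows-or-closed (suc k) with grows-or-closed k
  ... | inj₂ closed = inj₂ (closed-suc {k} closed)
  ... | inj₁ k<∣reachₖ∣ with any? (λ v → T? (reach (suc k) v) ×-dec ¬? (T? (reach k v)))
  ...   | yes (v , new , ¬old) =
    inj₁ (ℕP.≤-trans (s≤s k<∣reachₖ∣) (xAll-mono-< (λ w → reach-mono k {w}) v new ¬old))
  ...   | no nothing-new = inj₂ (closed-suc {k} closed)
    where
    closed : Closed k
    closed {v = v} ru e Sv with T? (reach k v)
    ... | yes rv  = rv
    ... | no ¬rv = contradiction (v , reach-step k ru e Sv , ¬rv) nothing-new

  reachₙ-closed : Closed n
  reachₙ-closed {v = v} with grows-or-closed n
  ... | inj₁ full   = λ _ _ _ → xAll-full (reach n) full v
  ... | inj₂ closed = closed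

  reached : ∀ {v} → T (S v) → T (reach n v)
  reached {v} Sv = along (S-connected root v root∈S Sv) (reach-root n)
    where
    along : ∀ {u w} → WalkIn G S u w → T (reach n u) → T (reach n w)
    along (here _)      ru = ru
    along (step _ e wk) ru = along wk (reachₙ-closed ru e (walk-start wk))

  dist : V → ℕ
  dist v = firstTrue (λ k → reach k v) n

  dist-≤ : ∀ v → dist v ≤ n
  dist-≤ v = firstTrue-≤ (λ k → reach k v) n

  dist-least : ∀ k {v} → T (reach k v) → dist v ≤ k
  dist-least k {v} = firstTrue-least (λ k → reach k v) n

  dist-reached : ∀ {v} → T (S v) → T (reach (dist v) v)
  dist-reached {v} Sv = firstTrue-holds (λ k → reach k v) n (reached Sv)

  dist-root : dist root ≡ 0
  dist-root = ℕP.n≤0⇒n≡0 (dist-least 0 (reach-root 0))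

  choose : ∀ {p} {P : Pred V p} → Dec (∃ P) → V
  choose (yes (u , _)) = u
  choose (no _)        = root

  choose-spec : ∀ {p} {P : Pred V p} (P? : Dec (∃ P)) → True P? → P (choose P?)
  choose-spec (yes (_ , Pu)) _ = Pu

  predecessor : ℕ → V → V
  predecessor zero    v = root
  predecessor (suc k) v = choose (incoming (reach k) v)

  parent : V → V
  parent v = predecessor (dist v) v

  parent-level : ∀ {v} → T (S v) → v ≢ root →
    ∃ λ k → dist v ≡ suc k × T (reach k (parent v)) × Edge G (parent v) v
  parent-level {v} Sv v≢root = level (dist v) refl
    where
    level : ∀ m → dist v ≡ m → ∃ λ k → m ≡ suc k × T (reach k (predecessor m v)) × Edge G (predecessor m v) v
    level zero dist≡0 = contradiction (toWitness (subst (λ k → T (reach k v)) dist≡0 (dist-reached Sv))) v≢root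
    level (suc k) dist≡1+k =
      k , refl , Equivalence.to T-∧ (choose-spec (incoming (reach k) v) (reach-new k rₖ₊₁v ¬rₖv))
      where
      rₖ₊₁v : T (reach (suc k) v)
      rₖ₊₁v = subst (λ j → T (reach j v)) dist≡1+k (dist-reached Sv)
      ¬rₖv : ¬ T (reach k v)
      ¬rₖv rₖv = ℕP.<-irrefl refl (subst (_≤ k) dist≡1+k (dist-least k rₖv))

  parent-spec : ∀ {v} → T (S v) → v ≢ root →
    T (S (parent v)) × Edge G (parent v) v × dist (parent v) < dist v
  parent-spec {v} Sv v≢root with parent-level Sv v≢root
  ... | k , dist≡1+k , rₖp , e =
    reach⊆S k rₖp , e , subst (dist (parent v) <_) (sym dist≡1+k) (s≤s (dist-least k rₖp))

  parent-of-neighbour : ∀ {v} → T (S v) → v ≢ root → Edge G root v → parent v ≡ root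
  parent-of-neighbour Sv v≢root e with parent-level Sv v≢root
  ... | k , dist≡1+k , rₖp , _ = toWitness (subst (λ j → T (reach j _)) k≡0 rₖp)
    where
    k≡0 : k ≡ 0
    k≡0 = ℕP.n≤0⇒n≡0 (ℕP.≤-pred (subst (_≤ 1) dist≡1+k (dist-least 1 (reach-step 0 (reach-root 0) e Sv))))

module Descent {c ℓ₁ ℓ₂} (O : DecStrictPartialOrder c ℓ₁ ℓ₂) where
  open DecStrictPartialOrder O using (_<?_; module Eq)
    renaming (Carrier to A; _<_ to _≺_; trans to ≺-trans; irrefl to ≺-irrefl)

  rank : ∀ {n} → (Fin n → A) → Fin n → ℕ
  rank d v = xAll (λ w → ⌊ d w <? d v ⌋)

  rank-mono-< : ∀ {n} (d : Fin n → A) {u v} → d u ≺ d v → rank d u < rank d v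
  rank-mono-< d {u} {v} du≺dv = xAll-mono-<
    (λ w dw≺du → fromWitness (≺-trans (toWitness {a? = d w <? d u} dw≺du) du≺dv))
    u (fromWitness du≺dv) (λ du≺du → ≺-irrefl Eq.refl (toWitness {a? = d u <? d u} du≺du))

  descend : ∀ {n} (G : Graph n) (S : Fin n → Bool) (d : Fin n → A) {b} {B : Pred (Fin n) b} → Decidable B →
    (∀ {v} → T (S v) → ¬ B v → ∃ λ u → T (S u) × Edge G u v × d u ≺ d v) →
    ∀ {v} → T (S v) → ∃ λ w → B w × WalkIn G S v w
  descend G S d {B = B} B? lower {v} Sv = go (On.wellFounded (rank d) <-wellFounded v) Sv
    where
    go : ∀ {v} → Acc (_<_ on rank d) v → T (S v) → ∃ λ w → B w × WalkIn G S v w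
    go {v} (acc down) Sv with B? v
    ... | yes Bv = v , Bv , here Sv
    ... | no ¬Bv with lower Sv ¬Bv
    ...   | u , Su , e , du≺dv with go (down (rank-mono-< d du≺dv)) Su
    ...     | w , Bw , walk = w , Bw , step Sv (edge-sym G e) walk

toℚ≡mkℚ : ∀ k → toℚ k ≡ mkℚ k 0 (Coprime.sym (1-coprimeTo _))
toℚ≡mkℚ k = ℚP.↥p/↧p≡p (mkℚ k 0 (Coprime.sym (1-coprimeTo _)))

toℚ-homo-+ : ∀ a b → toℚ (a ℤ.+ b) ≡ toℚ a ℚ.+ toℚ b
toℚ-homo-+ a b rewrite toℚ≡mkℚ a | toℚ≡mkℚ b
  = cong toℚ (sym (cong₂ ℤ._+_ (ℤP.*-identityʳ a) (ℤP.*-identityʳ b)))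

toℚ-mono-≤ : ∀ {a b} → a ℤ.≤ b → toℚ a ℚ.≤ toℚ b
toℚ-mono-≤ {a} {b} a≤b rewrite toℚ≡mkℚ a | toℚ≡mkℚ b
  = ℚ.*≤* (subst₂ ℤ._≤_ (sym (ℤP.*-identityʳ a)) (sym (ℤP.*-identityʳ b)) a≤b)

toℚ-bound : ∀ a b c {e} → (a ℤ.+ b) ℤ.+ c ℤ.≤ e → toℚ e ℚ.≥ (toℚ a ℚ.+ toℚ b) ℚ.+ toℚ c
toℚ-bound a b c {e} ≤e = subst (ℚ._≤ toℚ e)
  (trans (toℚ-homo-+ (a ℤ.+ b) c) (cong (ℚ._+ toℚ c) (toℚ-homo-+ a b))) (toℚ-mono-≤ ≤e)

potential-rises : ∀ m {zb xb p q} → T zb → T xb →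
  q ℚ.≥ (toℚ (+ m ℤ.* (b2z zb ℤ.- + 1)) ℚ.+ p) ℚ.+ toℚ (b2z xb) → p ℚ.< q
potential-rises m {true} {true} {p} {q} _ _ q≥ rewrite ℤP.*-zeroʳ (+ m) = ℚP.<-≤-trans p<0+p+1 q≥
  where
  p<0+p+1 : p ℚ.< (ℚ.0ℚ ℚ.+ p) ℚ.+ ℚ.1ℚ
  p<0+p+1 = subst₂ ℚ._<_ (ℚP.+-identityʳ p) (cong (ℚ._+ ℚ.1ℚ) (sym (ℚP.+-identityˡ p)))
                          (ℚP.+-monoʳ-< p (ℚP.positive⁻¹ ℚ.1ℚ))

tree-arc-bound : ∀ m {a b} → a < b → ((+ m ℤ.* (+ 1 ℤ.- + 1)) ℤ.+ + a) ℤ.+ + 1 ℤ.≤ + b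
tree-arc-bound m {a} {b} a<b rewrite ℤP.*-zeroʳ (+ m) = ℤ.+≤+ (subst (_≤ b) (ℕP.+-comm 1 a) a<b)

other-arc-bound : ∀ m {a b c} → a + c ≤ m → ((+ m ℤ.* (+ 0 ℤ.- + 1)) ℤ.+ + a) ℤ.+ + c ℤ.≤ + b
other-arc-bound m {a} {b} {c} a+c≤m = begin
  (+ m ℤ.* ℤ.-1ℤ ℤ.+ + a) ℤ.+ + c  ≡⟨ cong (λ t → (t ℤ.+ + a) ℤ.+ + c) (trans (ℤP.*-comm (+ m) ℤ.-1ℤ) (ℤP.-1*i≡-i (+ m))) ⟩
  (ℤ.- + m ℤ.+ + a) ℤ.+ + c        ≡⟨ cong (ℤ._+ + c) (trans (ℤP.+-comm (ℤ.- + m) (+ a)) (ℤP.m-n≡m⊖n a m)) ⟩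
  (a ℤ.⊖ m) ℤ.+ + c                ≡⟨ ℤP.distribˡ-⊖-+-pos c a m ⟩
  (a + c) ℤ.⊖ m                    ≡⟨ ℤP.⊖-≤ a+c≤m ⟩
  ℤ.- + (m ∸ (a + c))              ≤⟨ ℤP.neg-≤-pos ⟩
  + b                              ∎
  where open ℤP.≤-Reasoning

Feasible : ∀ {n} → Graph n → (r r₁ : Fin n) → (Fin n → Bool) → (Fin n → Fin n → Bool) → (Fin n → ℚ) → Set
Feasible {n} G r r₁ x z d =
  (∀ u v → Arc G r r₁ u v → b2n (x u) + b2n (x v) ≥ 1)
  × (∀ v → v ≢ r → v ≢ r₁ → zIn G r r₁ z v ≡ b2n (x v))
  × (∀ u v → Arc G r r₁ u v →
       d v ℚ.≥ (toℚ ((+ n) ℤ.* (b2z (z u v) ℤ.- + 1)) ℚ.+ d u) ℚ.+ toℚ (b2z (x v)))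
  × d r ≡ ℚ.0ℚ
  × (ℤ.+ zAll G r r₁ z) ≡ (ℤ.+ xAll x) ℤ.- + 1
  × (∀ u v → Arc G r r₁ u v → b2n (z u v) ≤ b2n (x u) × b2n (z u v) ≤ b2n (x v))

module _ {n} (G : Graph n) {r r₁ : Fin n} (rr₁ : Edge G r r₁) {C : Fin n → Bool}
  {z : Fin n → Fin n → Bool} {d : Fin n → ℚ} where

  open Descent (StrictTotalOrder.decStrictPartialOrder ℚP.<-strictTotalOrder)

  feasible⇒connectedVertexCover : Feasible G r r₁ C z d → ConnectedVertexCover G C
  feasible⇒connectedVertexCover (arcs-covered , in-degree , potential , _ , _ , z≤x) =
    cover , connected-via-edge G C rr₁ (λ v → descend G C d end? lower-neighbour)
    where
    cover : VertexCover G C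
    cover u v e with edge⇒arc G r r₁ e
    ... | inj₁ uv = b2n-sum⇒∨ (C u) (C v) (arcs-covered u v uv)
    ... | inj₂ vu = subst T (∨-comm (C v) (C u)) (b2n-sum⇒∨ (C v) (C u) (arcs-covered v u vu))

    end? : ∀ v → Dec (v ≡ r ⊎ v ≡ r₁)
    end? v = v ≟ r ⊎-dec v ≟ r₁

    lower-neighbour : ∀ {v} → T (C v) → ¬ (v ≡ r ⊎ v ≡ r₁) → ∃ λ u → T (C u) × Edge G u v × d u ℚ.< d v
    lower-neighbour {v} Cv v∉ends with incoming-z-arc G r r₁ z zIn≡1
      where
      zIn≡1 : zIn G r r₁ z v ≡ 1
      zIn≡1 = trans (in-degree v (v∉ends ∘ inj₁) (v∉ends ∘ inj₂)) (cong b2n (Equivalence.to T-≡ Cv))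
    ... | u , uv , zuv =
      u , b2n-≤⇒ (proj₁ (z≤x u v uv)) zuv , arc⇒edge G r r₁ uv , potential-rises n zuv Cv (potential u v uv)

module TreeSolution {n} (G : Graph (suc n)) {r r₁ : Fin (suc n)} (rr₁ : Edge G r r₁)
  {C : Fin (suc n) → Bool} (cover : VertexCover G C) (connected : InducedConnected G C) where

  -- The edge rr₁ puts r or r₁ into C, and (ii) says nothing about either, so either may be the root.
  root : Fin (suc n)
  root = if C r then r else r₁

  root∈C : T (C root)
  root∈C with C r in Cr≡
  ... | true  = subst T (sym Cr≡) tt
  ... | false = subst (λ b → T (b ∨ C r₁)) Cr≡ (cover r r₁ rr₁)

  root≡r : T (C r) → root ≡ r
  root≡r Cr with C r
  ... | true = refl

  root-cases : root ≡ r ⊎ root ≡ r₁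
  root-cases with C r
  ... | true  = inj₁ refl
  ... | false = inj₂ refl

  open BreadthFirstTree G C root root∈C connected

  inTree : V → Bool
  inTree v = C v ∧ not (v == root)

  z : V → V → Bool
  z u v = (u == parent v) ∧ inTree v

  -- Vertices outside C get height 0, so that d r = 0 also when r ∉ C.
  height : V → ℕ
  height v = if C v then dist v else 0

  d : V → ℚ
  d v = toℚ (+ height v)

  inTree-spec : ∀ {v} → T (inTree v) → T (C v) × v ≢ root
  inTree-spec {v} t with Equivalence.to T-∧ t
  ... | Cv , v≠root = Cv , toWitnessFalse {a? = v ≟ root} v≠root

  z-spec : ∀ {u v} → T (z u v) → u ≡ parent v × T (inTree v)
  z-spec {u} {v} t with Equivalence.to T-∧ t
  ... | u≡parent , tree = toWitness {a? = u ≟ parent v} u≡parent , tree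

  z⇒tail∈C : ∀ {u v} → T (z u v) → T (C v)
  z⇒tail∈C {u} {v} = proj₁ ∘ inTree-spec ∘ proj₂ ∘ z-spec {u} {v}

  z⇒head∈C : ∀ {u v} → T (z u v) → T (C u)
  z⇒head∈C {u} {v} t with z-spec {u} {v} t
  ... | u≡parent , tree = let Cv , v≢root = inTree-spec tree in
    subst (T ∘ C) (sym u≡parent) (proj₁ (parent-spec Cv v≢root))

  nonroot≢r : ∀ {v} → T (C v) → v ≢ root → v ≢ r
  nonroot≢r Cv v≢root refl = v≢root (sym (root≡r Cv))

  ends≢root : ∀ {v} → v ≢ r → v ≢ r₁ → v ≢ root
  ends≢root v≢r v≢r₁ v≡root = [ v≢r ∘ trans v≡root , v≢r₁ ∘ trans v≡root ] root-cases

  -- The only arc of D into r₁ is (r, r₁), and breadth-first search makes r the parent of r₁.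
  arc-into-r₁ : T (C r₁) → r₁ ≢ root → Arc G r r₁ (parent r₁) r₁
  arc-into-r₁ Cr₁ r₁≢root = subst (λ p → Arc G r r₁ p r₁) (sym parent≡r) (arc-from-r G r r₁ rr₁)
    where
    root≡r′ : root ≡ r
    root≡r′ with root-cases
    ... | inj₁ root≡r  = root≡r
    ... | inj₂ root≡r₁ = contradiction (sym root≡r₁) r₁≢root
    parent≡r : parent r₁ ≡ r
    parent≡r = trans (parent-of-neighbour Cr₁ r₁≢root (subst (λ w → Edge G w r₁) (sym root≡r′) rr₁)) root≡r′

  tree-arc : ∀ {v} → T (inTree v) → Arc G r r₁ (parent v) v
  tree-arc {v} t = orient (v ≟ r₁)
    where
    Cv : T (C v)
    Cv = proj₁ (inTree-spec t)
    v≢root : v ≢ root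
    v≢root = proj₂ (inTree-spec t)
    orient : Dec (v ≡ r₁) → Arc G r r₁ (parent v) v
    orient (yes v≡r₁) = subst (λ w → Arc G r r₁ (parent w) w) (sym v≡r₁)
      (arc-into-r₁ (subst (T ∘ C) v≡r₁ Cv) (v≢root ∘ trans v≡r₁))
    orient (no v≢r₁) =
      arc-intro G r r₁ (proj₁ (proj₂ (parent-spec Cv v≢root))) (nonroot≢r Cv v≢root) (inj₂ v≢r₁)

  zIn≡inTree : ∀ v → zIn G r r₁ z v ≡ b2n (inTree v)
  zIn≡inTree v = trans (sumFin-single (suc n) _ (parent v) off-tree) on-tree
    where
    off-tree : ∀ u → u ≢ parent v → onArc G r r₁ z u v ≡ 0
    off-tree u u≢parent rewrite ==-≢ u≢parent = cong b2n (∧-zeroʳ (arc G r r₁ u v))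
    on-tree : onArc G r r₁ z (parent v) v ≡ b2n (inTree v)
    on-tree rewrite ==-refl (parent v) with inTree v in inTree≡
    ... | false = cong b2n (∧-zeroʳ (arc G r r₁ (parent v) v))
    ... | true  = cong b2n (trans (∧-identityʳ _) (Equivalence.to T-≡ (tree-arc (subst T (sym inTree≡) tt))))

  C-split : ∀ v → b2n (C v) ≡ b2n (inTree v) + b2n (v == root)
  C-split v with v ≟ root
  ... | yes refl rewrite Equivalence.to T-≡ root∈C = refl
  ... | no _ = trans (cong b2n (sym (∧-identityʳ (C v)))) (sym (ℕP.+-identityʳ _))

  zAll≡∣inTree∣ : zAll G r r₁ z ≡ xAll inTree
  zAll≡∣inTree∣ = trans (sumFin-comm (suc n) (suc n) (onArc G r r₁ z)) (sumFin-cong (suc n) zIn≡inTree)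

  ∣C∣≡1+∣inTree∣ : xAll C ≡ suc (xAll inTree)
  ∣C∣≡1+∣inTree∣ = begin
    xAll C
      ≡⟨ sumFin-cong (suc n) C-split ⟩
    sumFin (suc n) (λ v → b2n (inTree v) + b2n (v == root))
      ≡⟨ sumFin-distrib-+ (suc n) (b2n ∘ inTree) (λ v → b2n (v == root)) ⟩
    xAll inTree + xAll (_== root)
      ≡⟨ cong (_+_ (xAll inTree)) (xAll-singleton root) ⟩
    xAll inTree + 1
      ≡⟨ ℕP.+-comm (xAll inTree) 1 ⟩
    suc (xAll inTree)
      ∎
    where open ≡-Reasoning

  height-≤ : ∀ v → height v ≤ n
  height-≤ v with C v
  ... | true  = dist-≤ v
  ... | false = z≤n

  height-∈C : ∀ {v} → T (C v) → height v ≡ dist v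
  height-∈C Cv rewrite Equivalence.to T-≡ Cv = refl

  height-∉C : ∀ {v} → ¬ T (C v) → height v ≡ 0
  height-∉C {v} ¬Cv with C v
  ... | true  = contradiction tt ¬Cv
  ... | false = refl

  height-r : height r ≡ 0
  height-r with T? (C r)
  ... | yes Cr = trans (height-∈C Cr) (trans (cong dist (sym (root≡r Cr))) dist-root)
  ... | no ¬Cr = height-∉C ¬Cr

  arc-bound : ∀ u v → ((+ suc n ℤ.* (b2z (z u v) ℤ.- + 1)) ℤ.+ + height u) ℤ.+ b2z (C v) ℤ.≤ + height v
  arc-bound u v with z u v in z≡
  ... | false = other-arc-bound (suc n) {height u} {c = b2n (C v)}
    (subst (height u + b2n (C v) ≤_) (ℕP.+-comm n 1) (ℕP.+-mono-≤ (height-≤ u) (b2n≤1 (C v))))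
  ... | true with z-spec {u} {v} (subst T (sym z≡) tt)
  ...   | u≡parent , tree with inTree-spec tree
  ...     | Cv , v≢root with parent-spec Cv v≢root
  ...       | Cparent , _ , parent<v
    rewrite height-∈C (subst (T ∘ C) (sym u≡parent) Cparent) | height-∈C Cv | Equivalence.to T-≡ Cv
    = tree-arc-bound (suc n) (subst (λ p → dist p < dist v) (sym u≡parent) parent<v)

  feasible : Feasible G r r₁ C z d
  feasible =
      (λ u v uv → ∨⇒b2n-sum (C u) (C v) (cover u v (arc⇒edge G r r₁ uv)))
    , (λ v v≢r v≢r₁ → trans (zIn≡inTree v) (cong b2n (inTree≡C v≢r v≢r₁)))
    , (λ u v _ → toℚ-bound (+ suc n ℤ.* (b2z (z u v) ℤ.- + 1)) (+ height u) (b2z (C v)) (arc-bound u v))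
    , cong (λ h → toℚ (+ h)) height-r
    , subst₂ (λ a b → + a ≡ + b ℤ.- + 1) (sym zAll≡∣inTree∣) (sym ∣C∣≡1+∣inTree∣) refl
    , (λ u v _ → b2n-mono (z⇒head∈C {u} {v}) , b2n-mono (z⇒tail∈C {u} {v}))
    where
    inTree≡C : ∀ {v} → v ≢ r → v ≢ r₁ → inTree v ≡ C v
    inTree≡C {v} v≢r v≢r₁ rewrite ==-≢ (ends≢root v≢r v≢r₁) = ∧-identityʳ (C v)

connectedVertexCover⇒feasible : ∀ {n} (G : Graph (suc n)) {r r₁} → Edge G r r₁ → ∀ {C} →
  ConnectedVertexCover G C →
  Σ (Fin (suc n) → Fin (suc n) → Bool) λ z → Σ (Fin (suc n) → ℚ) λ d → Feasible G r r₁ C z d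
connectedVertexCover⇒feasible G rr₁ (cover , connected) = z , d , feasible
  where open TreeSolution G rr₁ cover connected

theorem1 : (n : ℕ) (G : Graph n) → Connected G →
    (r r₁ : Fin n) → Edge G r r₁ →
    (C : Fin n → Bool) →
    ConnectedVertexCover G C ⇔
      Σ (Fin n → Fin n → Bool) (λ z → Σ (Fin n → ℚ) (λ d →
        let x = C in
        (∀ u v → Arc G r r₁ u v → b2n (x u) + b2n (x v) ≥ 1)
        × (∀ v → v ≢ r → v ≢ r₁ → zIn G r r₁ z v ≡ b2n (x v))
        × (∀ u v → Arc G r r₁ u v →
             d v ℚ.≥ (toℚ ((+ n) ℤ.* (b2z (z u v) ℤ.- + 1)) ℚ.+ d u) ℚ.+ toℚ (b2z (x v)))
        × d r ≡ ℚ.0ℚ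
        × (ℤ.+ zAll G r r₁ z) ≡ (ℤ.+ xAll x) ℤ.- + 1
        × (∀ u v → Arc G r r₁ u v → b2n (z u v) Data.Nat.≤ b2n (x u) × b2n (z u v) Data.Nat.≤ b2n (x v))))
theorem1 zero    G _ () _ _ _
theorem1 (suc n) G _ r r₁ rr₁ C = mk⇔
  (connectedVertexCover⇒feasible G rr₁)
  (λ (z , d , feasible) → feasible⇒connectedVertexCover G rr₁ feasible)
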